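{- Let $d$ be a positive integer and let $G$ be a finite $(X,Y)$-bigraph with maximum degree at most $d$ and girth at least $4ed^2+1$ (where $e$ is Euler's number). Assume that there exists a collection of pairwise vertex-disjoint cycles in $G$ whose union contains every vertex of $X$ (such a collection exists in particular if $G$ is $d$-regular). Then $G$ has a path $X$-cover consisting of at most $\alpha_{\mathsf{\Lambda}}(G)$ paths.
   Context: An $(X,Y)$-bigraph is a bipartite graph together with a specified ordered bipartition $(X,Y)$ of its vertex set. The girth is the length of a shortest cycle. A path $X$-cover of $G$ is a set of pairwise vertex-disjoint paths in $G$ (paths of length $0$ allowed) whose union contains every vertex of $X$. For $S \subseteq X$, let ${\mathsf{\Lambda}}(S)$ denote the set of vertices of $Y$ that have at least two neighbors in $S$. A set $S \subseteq X$ is ${\mathsf{\Lambda}}$-independent if ${\mathsf{\Lambda}}(S) = \varnothing$. The ${\mathsf{\Lambda}}$-independence number $\alpha_{\mathsf{\Lambda}}(G)$ is the maximum size of a ${\mathsf{\Lambda}}$-independent subset of $X$. -}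

module Defs where

open import Data.Nat using (ℕ; zero; suc; _+_; _*_; _∸_; _≤_)
open import Data.Nat using (_!)
open import Data.Bool using (Bool; true; false)
open import Data.Fin using (Fin)
open import Data.Fin.Subset using (Subset; _∈_; ∣_∣)
open import Data.List using (List; []; _∷_; length; filter; map; sum)
open import Data.List.Base using (last)
open import Data.Maybe using (Maybe; just; nothing)
open import Data.List.Membership.Propositional renaming (_∈_ to _∈ₗ_)
open import Data.List.Relation.Unary.Unique.Propositional using (Unique)
open import Data.List.Relation.Unary.Linked using (Linked)
open import Data.List.Relation.Unary.All using (All)
open import Data.List.Relation.Unary.AllPairs using (AllPairs)
open import Data.Sum using (_⊎_; inj₁; inj₂)
open import Data.Product using (Σ; _×_; ∃-syntax)
open import Data.Empty using (⊥)
open import Data.Unit using (⊤)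
open import Relation.Binary.PropositionalEquality using (_≡_)
open import Relation.Nullary using (¬_)
open import Data.Bool.Properties using () renaming (_≟_ to _≟B_)
open import Data.List.Base using () renaming (allFin to allFinL)

-- A finite (X,Y)-bigraph: X = Fin m, Y = Fin n, edges given by a Boolean
-- adjacency relation between X and Y (simple graph, all edges go between X and Y).
record Bigraph : Set where
  field
    m   : ℕ
    n   : ℕ
    adj : Fin m → Fin n → Bool
open Bigraph public

Vertex : Bigraph → Set
Vertex G = Fin (m G) ⊎ Fin (n G)

Adj : (G : Bigraph) → Vertex G → Vertex G → Set
Adj G (inj₁ x) (inj₂ y) = adj G x y ≡ true
Adj G (inj₂ y) (inj₁ x) = adj G x y ≡ true
Adj G (inj₁ _) (inj₁ _) = ⊥
Adj G (inj₂ _) (inj₂ _) = ⊥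

degX : (G : Bigraph) → Fin (m G) → ℕ
degX G x = length (filter (λ y → adj G x y ≟B true) (allFinL (n G)))

degY : (G : Bigraph) → Fin (n G) → ℕ
degY G y = length (filter (λ x → adj G x y ≟B true) (allFinL (m G)))

MaxDegreeAtMost : Bigraph → ℕ → Set
MaxDegreeAtMost G d = (∀ x → degX G x ≤ d) × (∀ y → degY G y ≤ d)

IsPath : (G : Bigraph) → List (Vertex G) → Set
IsPath G []      = ⊥
IsPath G (v ∷ vs) = Unique (v ∷ vs) × Linked (Adj G) (v ∷ vs)

-- A cycle v₀ v₁ … v_{k-1} v₀ with k ≥ 3 distinct vertices; its length is k.
ClosesUp : (G : Bigraph) → List (Vertex G) → Set
ClosesUp G []       = ⊥
ClosesUp G (v ∷ vs) with last (v ∷ vs)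
... | just w  = Adj G w v
... | nothing = ⊥

IsCycle : (G : Bigraph) → List (Vertex G) → Set
IsCycle G c = (3 ≤ length c) × Unique c × Linked (Adj G) c × ClosesUp G c

Disjoint : {A : Set} → List A → List A → Set
Disjoint c c' = ∀ v → v ∈ₗ c → ¬ (v ∈ₗ c')

CoversX : (G : Bigraph) → List (List (Vertex G)) → Set
CoversX G cs = ∀ x → ∃[ c ] (c ∈ₗ cs × inj₁ x ∈ₗ c)

CycleXCover : (G : Bigraph) → List (List (Vertex G)) → Set
CycleXCover G cs = All (IsCycle G) cs × AllPairs Disjoint cs × CoversX G cs

PathXCover : (G : Bigraph) → List (List (Vertex G)) → Set
PathXCover G ps = All (IsPath G) ps × AllPairs Disjoint ps × CoversX G ps

ΛIndependent : (G : Bigraph) → Subset (m G) → Set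
ΛIndependent G S = ∀ (y : Fin (n G)) (x₁ x₂ : Fin (m G)) →
  x₁ ∈ S → x₂ ∈ S → adj G x₁ y ≡ true → adj G x₂ y ≡ true → x₁ ≡ x₂

IsαΛ : Bigraph → ℕ → Set
IsαΛ G k = (∃[ S ] (ΛIndependent G S × ∣ S ∣ ≡ k))
         × (∀ S → ΛIndependent G S → ∣ S ∣ ≤ k)

-- eNum k = Σ_{i=0}^{k} k!/i!, so eNum k / k! is the k-th partial sum of e.
eNum : ℕ → ℕ
eNum zero    = 1
eNum (suc k) = suc k * eNum k + 1

-- L ≥ 4 e d² + 1, i.e. L - 1 ≥ 4 e d² ⇔ for every k, L - 1 ≥ 4 d² Σ_{i≤k} 1/i!
-- (e is the supremum of its partial sums).
AtLeast4ed²+1 : ℕ → ℕ → Set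
AtLeast4ed²+1 d L = ∀ k → 4 * (d * d) * eNum k ≤ (L ∸ 1) * (k !)

GirthAtLeast4ed²+1 : Bigraph → ℕ → Set
GirthAtLeast4ed²+1 G d = ∀ c → IsCycle G c → AtLeast4ed²+1 d (length c)

-- Each cycle of the given cover, read as a path, already works.  A cycle alternates
-- between X and Y and has length at least 4d² + 1, so it contains at least 2d² ≥ d² + 1
-- vertices of X.  On the other hand, a maximum Λ-independent set S dominates X at
-- distance two (otherwise it could be enlarged), and a vertex of X has at most d²
-- vertices of X at distance two, so |X| ≤ α_Λ(G)(d² + 1).  Disjointness of the cycles
-- then bounds their number by α_Λ(G).
module Submission where

open import Defs
open import Data.Nat using (ℕ; _≤_)
open import Data.List using (List; length)
open import Data.Product using (∃-syntax; _×_)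

open import Data.Nat using (suc; _+_; _*_; _∸_; _<_; z≤n; s≤s)
open import Data.Nat.Properties
open import Data.Bool using (true)
open import Data.Bool.Properties using () renaming (_≟_ to _≟B_)
open import Data.Fin using (Fin) renaming (_≟_ to _≟F_)
import Data.Fin as Fin
open import Data.Fin.Subset using (Subset; ∣_∣; ⁅_⁆; _∪_; inside; outside)
import Data.Fin.Subset as Subset
open import Data.Fin.Subset.Properties
  using (x∈p∪q⁻; x∈p∪q⁺; x∈⁅x⁆; x∈⁅y⁆⇒x≡y; p⊂q⇒∣p∣<∣q∣; p⊆p∪q)
open import Data.Vec using ([]; _∷_)
import Data.Vec as Vec
open import Data.List using ([]; _∷_; filter; map; concatMap)
open import Data.List.Base using () renaming (allFin to allFinL)
open import Data.List.Properties using (length-++; length-map; length-tabulate; filter-notAll)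
open import Data.List.Membership.Propositional using (_∈_)
open import Data.List.Membership.Propositional.Properties
  using (∈-allFin; ∈-filter⁺; ∈-map⁺; ∈-concat⁺′)
open import Data.List.Relation.Binary.Subset.Propositional using (_⊆_)
import Data.List.Relation.Binary.Disjoint.Propositional as List
open import Data.List.Relation.Unary.Any using (here; there; any?)
import Data.List.Relation.Unary.Any as Any
open import Data.List.Relation.Unary.All using (All; []; _∷_)
import Data.List.Relation.Unary.All as All
import Data.List.Relation.Unary.All.Properties as All
open import Data.List.Relation.Unary.AllPairs using (AllPairs; []; _∷_)
import Data.List.Relation.Unary.AllPairs as AllPairs
import Data.List.Relation.Unary.AllPairs.Properties as AllPairs
open import Data.List.Relation.Unary.Linked using (Linked; _∷_)
open import Data.List.Relation.Unary.Unique.Propositional using (Unique)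
import Data.List.Relation.Unary.Unique.Propositional.Properties as Unique
open import Data.Sum using (_⊎_; inj₁; inj₂)
open import Data.Product using (_,_; proj₁; proj₂)
open import Data.Empty using (⊥; ⊥-elim)
open import Relation.Nullary using (¬_; yes; no; ¬?)
open import Relation.Binary.Definitions using (DecidableEquality)
open import Relation.Binary.PropositionalEquality using (_≡_; refl; sym; trans; cong; subst)

module _ {a} {A : Set a} (_≟_ : DecidableEquality A) where

  Unique-⊆⇒length≤ : ∀ {xs ys : List A} → Unique xs → xs ⊆ ys → length xs ≤ length ys
  Unique-⊆⇒length≤ {[]}     _ _ = z≤n
  Unique-⊆⇒length≤ {x ∷ xs} {ys} (x∉xs ∷ xs!) x∷xs⊆ys = begin-strict
    length xs               ≤⟨ Unique-⊆⇒length≤ xs! xs⊆ys-x ⟩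
    length (filter ≢x? ys)  <⟨ filter-notAll ≢x? ys (Any.map (λ x≡y y≢x → y≢x (sym x≡y)) (x∷xs⊆ys (here refl))) ⟩
    length ys               ∎
    where
    open ≤-Reasoning
    ≢x? = λ y → ¬? (y ≟ x)
    xs⊆ys-x : xs ⊆ filter ≢x? ys
    xs⊆ys-x v∈xs = ∈-filter⁺ ≢x? (x∷xs⊆ys (there v∈xs)) (λ v≡x → All.lookup x∉xs v∈xs (sym v≡x))

Unique⇒length≤ : ∀ {k} {xs : List (Fin k)} → Unique xs → length xs ≤ k
Unique⇒length≤ {k} {xs} xs! =
  subst (length xs ≤_) (length-tabulate (λ i → i)) (Unique-⊆⇒length≤ _≟F_ xs! (λ {v} _ → ∈-allFin v))

allFin-⊆⇒≤length : ∀ {k} {xs : List (Fin k)} → allFinL k ⊆ xs → k ≤ length xs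
allFin-⊆⇒≤length {k} {xs} ⊆xs =
  subst (_≤ length xs) (length-tabulate (λ i → i)) (Unique-⊆⇒length≤ _≟F_ (Unique.allFin⁺ k) ⊆xs)

module _ {a b} {A : Set a} {B : Set b} (f : A → List B) (k : ℕ) where

  length-concatMap≤ : (∀ x → length (f x) ≤ k) → ∀ xs → length (concatMap f xs) ≤ length xs * k
  length-concatMap≤ bound []       = z≤n
  length-concatMap≤ bound (x ∷ xs) rewrite length-++ (f x) {concatMap f xs} =
    +-mono-≤ (bound x) (length-concatMap≤ bound xs)

  length-concatMap≥ : ∀ {xs} → All (λ x → k ≤ length (f x)) xs → length xs * k ≤ length (concatMap f xs)
  length-concatMap≥ {[]}     []       = z≤n
  length-concatMap≥ {x ∷ xs} (p ∷ ps) rewrite length-++ (f x) {concatMap f xs} =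
    +-mono-≤ p (length-concatMap≥ ps)

1+n≤2*n : ∀ {n} → 1 ≤ n → suc n ≤ 2 * n
1+n≤2*n {n} 1≤n = subst (suc n ≤_) (cong (n +_) (sym (+-identityʳ n))) (+-monoˡ-≤ n 1≤n)

elements : ∀ {k} → Subset k → List (Fin k)
elements []            = []
elements (inside ∷ p)  = Fin.zero ∷ map Fin.suc (elements p)
elements (outside ∷ p) = map Fin.suc (elements p)

length-elements : ∀ {k} (p : Subset k) → length (elements p) ≡ ∣ p ∣
length-elements []            = refl
length-elements (inside ∷ p)  = cong suc (trans (length-map Fin.suc (elements p)) (length-elements p))
length-elements (outside ∷ p) = trans (length-map Fin.suc (elements p)) (length-elements p)

∈-elements : ∀ {k} {x : Fin k} (p : Subset k) → x Subset.∈ p → x ∈ elements p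
∈-elements (inside ∷ p)  Vec.here      = here refl
∈-elements (inside ∷ p)  (Vec.there q) = there (∈-map⁺ Fin.suc (∈-elements p q))
∈-elements (outside ∷ p) (Vec.there q) = ∈-map⁺ Fin.suc (∈-elements p q)

lefts : ∀ {a b} {A : Set a} {B : Set b} → List (A ⊎ B) → List A
lefts []            = []
lefts (inj₁ a ∷ vs) = a ∷ lefts vs
lefts (inj₂ _ ∷ vs) = lefts vs

module _ {a b} {A : Set a} {B : Set b} where

  ∈-lefts⁻ : ∀ {x : A} (vs : List (A ⊎ B)) → x ∈ lefts vs → inj₁ x ∈ vs
  ∈-lefts⁻ (inj₁ _ ∷ vs) (here refl) = here refl
  ∈-lefts⁻ (inj₁ _ ∷ vs) (there p)   = there (∈-lefts⁻ vs p)
  ∈-lefts⁻ (inj₂ _ ∷ vs) p           = there (∈-lefts⁻ vs p)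

  Unique-lefts : ∀ {vs : List (A ⊎ B)} → Unique vs → Unique (lefts vs)
  Unique-lefts {[]}          []          = []
  Unique-lefts {inj₁ x ∷ vs} (x∉vs ∷ vs!) =
    All.tabulate (λ y∈ x≡y → All.lookup x∉vs (∈-lefts⁻ vs y∈) (cong inj₁ x≡y)) ∷ Unique-lefts vs!
  Unique-lefts {inj₂ _ ∷ vs} (_ ∷ vs!)    = Unique-lefts vs!

module _ {A B : Set} where

  Unique-concatMap-lefts : ∀ {vss : List (List (A ⊎ B))} →
    All Unique vss → AllPairs Disjoint vss → Unique (concatMap lefts vss)
  Unique-concatMap-lefts uniques disjoint = Unique.concat⁺
    (All.map⁺ (All.map Unique-lefts uniques))
    (AllPairs.map⁺ (AllPairs.map lefts-disjoint disjoint))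
    where
    lefts-disjoint : ∀ {vs ws} → Disjoint vs ws → List.Disjoint (lefts vs) (lefts ws)
    lefts-disjoint {vs} {ws} vs∩ws=∅ (v∈vs , v∈ws) = vs∩ws=∅ _ (∈-lefts⁻ vs v∈vs) (∈-lefts⁻ ws v∈ws)

module _ (G : Bigraph) where

  private
    length-fromX : ∀ x vs → Linked (Adj G) (inj₁ x ∷ vs) →
                   length (inj₁ x ∷ vs) ≤ 2 * length (lefts (inj₁ x ∷ vs))
    length-fromY : ∀ y vs → Linked (Adj G) (inj₂ y ∷ vs) →
                   length (inj₂ y ∷ vs) ≤ suc (2 * length (lefts (inj₂ y ∷ vs)))

    length-fromX x []            _        = s≤s z≤n
    length-fromX x (inj₁ _ ∷ _)  (() ∷ _)
    length-fromX x (inj₂ y ∷ vs) (_ ∷ lk) =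
      subst (2 + length vs ≤_) (sym (*-suc 2 (length (lefts vs)))) (s≤s (length-fromY y vs lk))

    length-fromY y []            _        = s≤s z≤n
    length-fromY y (inj₁ x ∷ vs) (_ ∷ lk) = s≤s (length-fromX x vs lk)
    length-fromY y (inj₂ _ ∷ _)  (() ∷ _)

  length≤1+2*lefts : ∀ vs → Linked (Adj G) vs → length vs ≤ suc (2 * length (lefts vs))
  length≤1+2*lefts []            _  = z≤n
  length≤1+2*lefts (inj₁ x ∷ vs) lk = m≤n⇒m≤1+n (length-fromX x vs lk)
  length≤1+2*lefts (inj₂ y ∷ vs) lk = length-fromY y vs lk

  IsCycle⇒IsPath : ∀ {c} → IsCycle G c → IsPath G c
  IsCycle⇒IsPath {[]}    (() , _)
  IsCycle⇒IsPath {_ ∷ _} (_ , c! , walk , _) = c! , walk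

  girth⇒2*d²≤lefts : ∀ d → GirthAtLeast4ed²+1 G d → ∀ c → IsCycle G c → 2 * (d * d) ≤ length (lefts c)
  girth⇒2*d²≤lefts d girth c cyc@(_ , _ , walk , _) = *-cancelˡ-≤ 2 (begin
    2 * (2 * (d * d))    ≡⟨ sym (*-assoc 2 2 (d * d)) ⟩
    4 * (d * d)          ≡⟨ sym (*-identityʳ _) ⟩
    4 * (d * d) * 1      ≤⟨ girth c cyc 0 ⟩
    (length c ∸ 1) * 1   ≡⟨ *-identityʳ _ ⟩
    length c ∸ 1         ≤⟨ ∸-monoˡ-≤ 1 (length≤1+2*lefts c walk) ⟩
    2 * length (lefts c) ∎)
    where open ≤-Reasoning

  ΛIndependent-∪⁅⁆ : ∀ {S x} → ΛIndependent G S →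
    (∀ {s y} → s Subset.∈ S → adj G s y ≡ true → adj G x y ≡ true → ⊥) →
    ΛIndependent G (S ∪ ⁅ x ⁆)
  ΛIndependent-∪⁅⁆ {S} {x} indep apart y x₁ x₂ x₁∈ x₂∈ x₁~y x₂~y
    with x∈p∪q⁻ S ⁅ x ⁆ x₁∈ | x∈p∪q⁻ S ⁅ x ⁆ x₂∈
  ... | inj₁ x₁∈S | inj₁ x₂∈S = indep y x₁ x₂ x₁∈S x₂∈S x₁~y x₂~y
  ... | inj₁ x₁∈S | inj₂ x₂∈x with refl ← x∈⁅y⁆⇒x≡y x x₂∈x = ⊥-elim (apart x₁∈S x₁~y x₂~y)
  ... | inj₂ x₁∈x | inj₁ x₂∈S with refl ← x∈⁅y⁆⇒x≡y x x₁∈x = ⊥-elim (apart x₂∈S x₂~y x₁~y)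
  ... | inj₂ x₁∈x | inj₂ x₂∈x = trans (x∈⁅y⁆⇒x≡y x x₁∈x) (sym (x∈⁅y⁆⇒x≡y x x₂∈x))

module _ (G : Bigraph) (d : ℕ) (maxDegree : MaxDegreeAtMost G d) where

  neighboursX : Fin (m G) → List (Fin (n G))
  neighboursX x = filter (λ y → adj G x y ≟B true) (allFinL (n G))

  neighboursY : Fin (n G) → List (Fin (m G))
  neighboursY y = filter (λ x → adj G x y ≟B true) (allFinL (m G))

  ball₂ : Fin (m G) → List (Fin (m G))
  ball₂ s = s ∷ concatMap neighboursY (neighboursX s)

  length-ball₂ : ∀ s → length (ball₂ s) ≤ suc (d * d)
  length-ball₂ s = s≤s (begin
    length (concatMap neighboursY (neighboursX s)) ≤⟨ length-concatMap≤ neighboursY d (proj₂ maxDegree) (neighboursX s) ⟩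
    length (neighboursX s) * d                     ≤⟨ *-monoˡ-≤ d (proj₁ maxDegree s) ⟩
    d * d                                          ∎)
    where open ≤-Reasoning

  ∈-ball₂ : ∀ {s x y} → adj G s y ≡ true → adj G x y ≡ true → x ∈ ball₂ s
  ∈-ball₂ {s} {x} {y} s~y x~y = there (∈-concat⁺′
    (∈-filter⁺ (λ x → adj G x y ≟B true) (∈-allFin x) x~y)
    (∈-map⁺ neighboursY (∈-filter⁺ (λ y → adj G s y ≟B true) (∈-allFin y) s~y)))

  maximum-ΛIndependent⇒allFin⊆ball₂ : ∀ {S} → ΛIndependent G S →
    (∀ T → ΛIndependent G T → ∣ T ∣ ≤ ∣ S ∣) →
    allFinL (m G) ⊆ concatMap ball₂ (elements S)
  maximum-ΛIndependent⇒allFin⊆ball₂ {S} indep maximum {x} _ with any? (x ≟F_) (concatMap ball₂ (elements S))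
  ... | yes x∈balls = x∈balls
  ... | no  x∉balls = ⊥-elim (<⇒≱ |S|<|S∪⁅x⁆| (maximum _ (ΛIndependent-∪⁅⁆ G indep apart)))
    where
    ∉ball₂ : ∀ {s} → s Subset.∈ S → ¬ (x ∈ ball₂ s)
    ∉ball₂ s∈S x∈ball = x∉balls (∈-concat⁺′ x∈ball (∈-map⁺ ball₂ (∈-elements S s∈S)))
    apart : ∀ {s y} → s Subset.∈ S → adj G s y ≡ true → adj G x y ≡ true → ⊥
    apart s∈S s~y x~y = ∉ball₂ s∈S (∈-ball₂ s~y x~y)
    |S|<|S∪⁅x⁆| : ∣ S ∣ < ∣ S ∪ ⁅ x ⁆ ∣
    |S|<|S∪⁅x⁆| = p⊂q⇒∣p∣<∣q∣
      (p⊆p∪q ⁅ x ⁆ , x , x∈p∪q⁺ (inj₂ (x∈⁅x⁆ x)) , λ x∈S → ∉ball₂ x∈S (here refl))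

  m≤αΛ*[1+d²] : ∀ {α} → IsαΛ G α → m G ≤ α * suc (d * d)
  m≤αΛ*[1+d²] ((S , indep , refl) , maximum) = begin
    m G                                   ≤⟨ allFin-⊆⇒≤length (maximum-ΛIndependent⇒allFin⊆ball₂ indep maximum) ⟩
    length (concatMap ball₂ (elements S)) ≤⟨ length-concatMap≤ ball₂ (suc (d * d)) length-ball₂ (elements S) ⟩
    length (elements S) * suc (d * d)     ≡⟨ cong (_* suc (d * d)) (length-elements S) ⟩
    ∣ S ∣ * suc (d * d)                   ∎
    where open ≤-Reasoning

theorem6 : (d : ℕ) → 1 ≤ d → (G : Bigraph) →
    MaxDegreeAtMost G d →
    GirthAtLeast4ed²+1 G d →
    ∃[ cs ] CycleXCover G cs →
    ∀ α → IsαΛ G α →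
    ∃[ ps ] (PathXCover G ps × length ps ≤ α)
theorem6 d 1≤d G maxDegree girth (cs , cycles , disjoint , covers) α isαΛ =
  cs , (All.map (IsCycle⇒IsPath G) cycles , disjoint , covers) ,
  *-cancelʳ-≤ (length cs) α (suc (d * d)) (begin
    length cs * suc (d * d)     ≤⟨ length-concatMap≥ lefts (suc (d * d)) (All.map many-lefts cycles) ⟩
    length (concatMap lefts cs) ≤⟨ Unique⇒length≤ (Unique-concatMap-lefts (All.map (λ (_ , c! , _) → c!) cycles) disjoint) ⟩
    m G                         ≤⟨ m≤αΛ*[1+d²] G d maxDegree isαΛ ⟩
    α * suc (d * d)             ∎)
  where
  open ≤-Reasoning
  many-lefts : ∀ {c} → IsCycle G c → suc (d * d) ≤ length (lefts c)
  many-lefts cyc = ≤-trans (1+n≤2*n (*-mono-≤ 1≤d 1≤d)) (girth⇒2*d²≤lefts G d girth _ cyc)
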